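{- Let $g(x),f(x)$ be formal power series with integer coefficients and $g(0)=f(0)=1$, let $A=(g(x),xf(x))$ with entries $a_{n,k}=[x^n]g(x)(xf(x))^k$, and let $A(x)$ be the generating function of the $A$-sequence of $A$. For an integer $r\ge0$ let $c(A;r)$ be the lower-triangular matrix with $(n,k)$ entry $a_{2n+r,n+k+r}$. Then $c(A;r)$ is a Riordan array and the generating function of its $A$-sequence is $A(x)^2$.
   Context: A Riordan array $(d(x),h(x))$, for formal power series $d,h$ with $d(0)\neq 0$, $h(0)=0$, $h'(0)\neq 0$, is the infinite lower-triangular matrix whose $(n,k)$ entry is $[x^n]d(x)h(x)^k$. The $A$-sequence $(\alpha_0,\alpha_1,\dots)$ of a Riordan array $D=(d_{n,k})=(d,h)$ is the sequence satisfying $d_{n+1,k+1}=\sum_{j\ge0}\alpha_j d_{n,k+j}$ for all $n,k\ge0$; its generating function is $x/\bar h(x)$, where $\bar h$ is the reversion of $h$ (the power series $u$ with $u(0)=0$ and $h(u(x))=x$). In particular $A(x)=x/\overline{xf(x)}$. -}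

module Defs where

open import Data.Nat using (ℕ; zero; suc; _∸_)
open import Data.Integer using (ℤ; _+_; _*_; 0ℤ; 1ℤ)
open import Relation.Binary.PropositionalEquality using (_≡_)
open import Relation.Nullary using (¬_)
open import Data.Product using (Σ; _×_)

PS : Set
PS = ℕ → ℤ

Σ≤ : ℕ → (ℕ → ℤ) → ℤ
Σ≤ zero    t = t 0
Σ≤ (suc n) t = Σ≤ n t + t (suc n)

_⊛_ : PS → PS → PS
(p ⊛ q) n = Σ≤ n (λ i → p i * q (n ∸ i))

infixl 7 _⊛_

one : PS
one zero    = 1ℤ
one (suc _) = 0ℤ

X : PS
X (suc zero) = 1ℤ
X _          = 0ℤ

_^ˢ_ : PS → ℕ → PS
p ^ˢ zero  = one
p ^ˢ suc k = p ⊛ (p ^ˢ k)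

-- Infinite matrices (lower triangular ones are those vanishing above the diagonal)
Matrix : Set
Matrix = ℕ → ℕ → ℤ

riordan : PS → PS → Matrix
riordan d h n k = (d ⊛ (h ^ˢ k)) n

IsRiordan : Matrix → Set
IsRiordan M = Σ PS λ d → Σ PS λ h →
  (¬ d 0 ≡ 0ℤ) × (h 0 ≡ 0ℤ) × (¬ h 1 ≡ 0ℤ) ×
  (∀ n k → M n k ≡ riordan d h n k)

-- α is the A-sequence of the (lower-triangular) array D:
--   d_{n+1,k+1} = Σ_{j≥0} α_j d_{n,k+j};  terms with k+j > n vanish,
--   so the sum is taken over j = 0..n.
IsASequence : Matrix → PS → Set
IsASequence D α = ∀ n k → D (suc n) (suc k) ≡ Σ≤ n (λ j → α j * D n (k Data.Nat.+ j))

cMat : Matrix → ℕ → Matrix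
cMat A r n k = A (n Data.Nat.+ n Data.Nat.+ r) (n Data.Nat.+ k Data.Nat.+ r)

{-# OPTIONS --safe #-}
-- The A-sequence relation expresses row n+1 of a lower-triangular array through row n; applied twice
-- it expresses row N+2 through row N with coefficients α ⊛ α, and c(A;r) keeps every other row of A,
-- shifted so that this double step is exactly its own A-sequence relation.  Conversely, a
-- lower-triangular array with an A-sequence β (β 0 ≠ 0) and first row (c,0,0,…) is the Riordan array
-- (d,h) with d its first column and h the solution of h = x β(h), built coefficient by coefficient.
module Submission where

open import Defs
open import Data.Nat as ℕ using (ℕ; zero; suc; _∸_; _≤_; _<_; z≤n; s≤s)
import Data.Nat.Properties as ℕ
import Data.Nat.Tactic.RingSolver as ℕ-Solver
open import Data.Integer using (ℤ; _+_; _*_; _^_; 0ℤ; 1ℤ)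
import Data.Integer.Properties as ℤ
open import Data.Integer.Tactic.RingSolver using (solve-∀)
open import Data.Empty using (⊥-elim)
open import Data.Product using (_×_; _,_)
open import Data.Sum using (inj₁; inj₂)
open import Function using (_∘_)
open import Relation.Binary.PropositionalEquality
open import Relation.Nullary using (¬_)

Σ≤-cong : ∀ n {s t : ℕ → ℤ} → (∀ i → i ≤ n → s i ≡ t i) → Σ≤ n s ≡ Σ≤ n t
Σ≤-cong zero    s≡t = s≡t 0 z≤n
Σ≤-cong (suc n) s≡t =
  cong₂ _+_ (Σ≤-cong n (λ i i≤n → s≡t i (ℕ.m≤n⇒m≤1+n i≤n))) (s≡t (suc n) ℕ.≤-refl)

Σ≤-distrib-+ : ∀ n (s t : ℕ → ℤ) → Σ≤ n (λ i → s i + t i) ≡ Σ≤ n s + Σ≤ n t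
Σ≤-distrib-+ zero    s t = refl
Σ≤-distrib-+ (suc n) s t rewrite Σ≤-distrib-+ n s t = interchange (Σ≤ n s) (Σ≤ n t) (s (suc n)) (t (suc n))
  where
  interchange : ∀ a b c d → a + b + (c + d) ≡ a + c + (b + d)
  interchange = solve-∀

*-distribˡ-Σ≤ : ∀ n c (t : ℕ → ℤ) → c * Σ≤ n t ≡ Σ≤ n (λ i → c * t i)
*-distribˡ-Σ≤ zero    c t = refl
*-distribˡ-Σ≤ (suc n) c t =
  trans (ℤ.*-distribˡ-+ c (Σ≤ n t) (t (suc n))) (cong (_+ c * t (suc n)) (*-distribˡ-Σ≤ n c t))

*-distribʳ-Σ≤ : ∀ n c (t : ℕ → ℤ) → Σ≤ n t * c ≡ Σ≤ n (λ i → t i * c)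
*-distribʳ-Σ≤ n c t = begin
  Σ≤ n t * c               ≡⟨ ℤ.*-comm (Σ≤ n t) c ⟩
  c * Σ≤ n t               ≡⟨ *-distribˡ-Σ≤ n c t ⟩
  Σ≤ n (λ i → c * t i)     ≡⟨ Σ≤-cong n (λ i _ → ℤ.*-comm c (t i)) ⟩
  Σ≤ n (λ i → t i * c)     ∎
  where open ≡-Reasoning

Σ≤-zero : ∀ n (t : ℕ → ℤ) → (∀ i → i ≤ n → t i ≡ 0ℤ) → Σ≤ n t ≡ 0ℤ
Σ≤-zero zero    t t≡0 = t≡0 0 z≤n
Σ≤-zero (suc n) t t≡0
  rewrite Σ≤-zero n t (λ i i≤n → t≡0 i (ℕ.m≤n⇒m≤1+n i≤n)) | t≡0 (suc n) ℕ.≤-refl = refl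

Σ≤-vanishing-tail : ∀ m n (t : ℕ → ℤ) → m ≤ n → (∀ i → m < i → i ≤ n → t i ≡ 0ℤ) →
                    Σ≤ n t ≡ Σ≤ m t
Σ≤-vanishing-tail m zero    t z≤n   _   = refl
Σ≤-vanishing-tail m (suc n) t m≤1+n t≡0 with ℕ.m≤n⇒m<n∨m≡n m≤1+n
... | inj₂ refl         = refl
... | inj₁ (s≤s m≤n) = begin
  Σ≤ n t + t (suc n)  ≡⟨ cong₂ _+_ (Σ≤-vanishing-tail m n t m≤n (λ i m<i i≤n → t≡0 i m<i (ℕ.m≤n⇒m≤1+n i≤n)))
                                     (t≡0 (suc n) (s≤s m≤n) ℕ.≤-refl) ⟩
  Σ≤ m t + 0ℤ         ≡⟨ ℤ.+-identityʳ _ ⟩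
  Σ≤ m t              ∎
  where open ≡-Reasoning

Σ≤-single : ∀ n j (t : ℕ → ℤ) → j ≤ n → (∀ i → i ≤ n → ¬ i ≡ j → t i ≡ 0ℤ) → Σ≤ n t ≡ t j
Σ≤-single n zero    t _   t≡0 = Σ≤-vanishing-tail 0 n t z≤n (λ { (suc i) _ i≤n → t≡0 (suc i) i≤n λ () })
Σ≤-single n (suc j) t j<n t≡0 = begin
  Σ≤ n t             ≡⟨ Σ≤-vanishing-tail (suc j) n t j<n above ⟩
  Σ≤ j t + t (suc j) ≡⟨ cong (_+ t (suc j)) (Σ≤-zero j t below) ⟩
  0ℤ + t (suc j)     ≡⟨ ℤ.+-identityˡ _ ⟩
  t (suc j)          ∎
  where
  open ≡-Reasoning
  above : ∀ i → suc j < i → i ≤ n → t i ≡ 0ℤ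
  above i j<i i≤n = t≡0 i i≤n (λ { refl → ℕ.<-irrefl refl j<i })
  below : ∀ i → i ≤ j → t i ≡ 0ℤ
  below i i≤j = t≡0 i (ℕ.≤-trans i≤j (ℕ.<⇒≤ j<n)) (λ { refl → ℕ.<-irrefl refl (s≤s i≤j) })

Σ≤-swap : ∀ n m (F : ℕ → ℕ → ℤ) → Σ≤ n (λ i → Σ≤ m (F i)) ≡ Σ≤ m (λ j → Σ≤ n (λ i → F i j))
Σ≤-swap zero    m F = refl
Σ≤-swap (suc n) m F rewrite Σ≤-swap n m F = sym (Σ≤-distrib-+ m (λ j → Σ≤ n (λ i → F i j)) (F (suc n)))

Σ≤-head : ∀ n (t : ℕ → ℤ) → Σ≤ (suc n) t ≡ t 0 + Σ≤ n (t ∘ suc)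
Σ≤-head zero    t = refl
Σ≤-head (suc n) t rewrite Σ≤-head n t = ℤ.+-assoc (t 0) _ _

Σ≤-reverse : ∀ n (t : ℕ → ℤ) → Σ≤ n t ≡ Σ≤ n (λ i → t (n ∸ i))
Σ≤-reverse zero    t = refl
Σ≤-reverse (suc n) t = begin
  Σ≤ n t + t (suc n)                       ≡⟨ cong (_+ t (suc n)) (Σ≤-reverse n t) ⟩
  Σ≤ n (λ i → t (n ∸ i)) + t (suc n)       ≡⟨ ℤ.+-comm (Σ≤ n (λ i → t (n ∸ i))) (t (suc n)) ⟩
  t (suc n) + Σ≤ n (λ i → t (n ∸ i))       ≡⟨ Σ≤-head n (λ i → t (suc n ∸ i)) ⟨
  Σ≤ (suc n) (λ i → t (suc n ∸ i))         ∎
  where open ≡-Reasoning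

Σ≤-triangle : ∀ n (F : ℕ → ℕ → ℤ) →
  Σ≤ n (λ i → Σ≤ i (F i)) ≡ Σ≤ n (λ j → Σ≤ (n ∸ j) (λ l → F (j ℕ.+ l) j))
Σ≤-triangle zero    F = refl
Σ≤-triangle (suc n) F = begin
    Σ≤ n (λ i → Σ≤ i (F i)) + (Σ≤ n (F (suc n)) + F (suc n) (suc n))
  ≡⟨ cong (_+ (Σ≤ n (F (suc n)) + F (suc n) (suc n))) (Σ≤-triangle n F) ⟩
    columns n + (Σ≤ n (F (suc n)) + F (suc n) (suc n))
  ≡⟨ ℤ.+-assoc (columns n) (Σ≤ n (F (suc n))) (F (suc n) (suc n)) ⟨
    columns n + Σ≤ n (F (suc n)) + F (suc n) (suc n)
  ≡⟨ cong₂ _+_ (sym (Σ≤-distrib-+ n _ _)) corner ⟩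
    Σ≤ n (λ j → Σ≤ (n ∸ j) (column j) + F (suc n) j) + Σ≤ (suc n ∸ suc n) (column (suc n))
  ≡⟨ cong (_+ Σ≤ (suc n ∸ suc n) (column (suc n))) (Σ≤-cong n extend) ⟩
    columns (suc n)
  ∎
  where
  open ≡-Reasoning
  column : ℕ → ℕ → ℤ
  column j l = F (j ℕ.+ l) j
  columns : ℕ → ℤ
  columns m = Σ≤ m (λ j → Σ≤ (m ∸ j) (column j))
  corner : F (suc n) (suc n) ≡ Σ≤ (n ∸ n) (column (suc n))
  corner = trans (cong (λ z → F z (suc n)) (sym (ℕ.+-identityʳ (suc n))))
                 (cong (λ m → Σ≤ m (column (suc n))) (sym (ℕ.n∸n≡0 n)))
  extend : ∀ j → j ≤ n → Σ≤ (n ∸ j) (column j) + F (suc n) j ≡ Σ≤ (suc n ∸ j) (column j)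
  extend j j≤n rewrite ℕ.+-∸-assoc 1 j≤n =
    cong (λ z → Σ≤ (n ∸ j) (column j) + F z j)
         (sym (trans (ℕ.+-suc j (n ∸ j)) (cong suc (ℕ.m+[n∸m]≡n j≤n))))

AgreeUpTo : ℕ → PS → PS → Set
AgreeUpTo n p q = ∀ i → i ≤ n → p i ≡ q i

AgreeUpTo-≤ : ∀ {m n p q} → m ≤ n → AgreeUpTo n p q → AgreeUpTo m p q
AgreeUpTo-≤ m≤n p≈q i i≤m = p≈q i (ℕ.≤-trans i≤m m≤n)

⊛-cong-at : ∀ n {p p' q q'} → AgreeUpTo n p p' → AgreeUpTo n q q' → (p ⊛ q) n ≡ (p' ⊛ q') n
⊛-cong-at n p≈p' q≈q' = Σ≤-cong n (λ i i≤n → cong₂ _*_ (p≈p' i i≤n) (q≈q' (n ∸ i) (ℕ.m∸n≤m n i)))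

⊛-congUpTo : ∀ n {p p' q q'} → AgreeUpTo n p p' → AgreeUpTo n q q' → AgreeUpTo n (p ⊛ q) (p' ⊛ q')
⊛-congUpTo n p≈p' q≈q' i i≤n = ⊛-cong-at i (AgreeUpTo-≤ i≤n p≈p') (AgreeUpTo-≤ i≤n q≈q')

⊛-congˡ : ∀ {p p'} q → p ≗ p' → p ⊛ q ≗ p' ⊛ q
⊛-congˡ q p≗p' n = ⊛-cong-at n {q = q} (λ i _ → p≗p' i) (λ _ _ → refl)

⊛-congʳ : ∀ p {q q'} → q ≗ q' → p ⊛ q ≗ p ⊛ q'
⊛-congʳ p q≗q' n = ⊛-cong-at n {p = p} (λ _ _ → refl) (λ i _ → q≗q' i)

⊛-comm : ∀ p q → p ⊛ q ≗ q ⊛ p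
⊛-comm p q n = trans (Σ≤-reverse n (λ i → p i * q (n ∸ i))) (Σ≤-cong n swap)
  where
  swap : ∀ i → i ≤ n → p (n ∸ i) * q (n ∸ (n ∸ i)) ≡ q i * p (n ∸ i)
  swap i i≤n rewrite ℕ.m∸[m∸n]≡n i≤n = ℤ.*-comm (p (n ∸ i)) (q i)

⊛-assoc : ∀ p q s → (p ⊛ q) ⊛ s ≗ p ⊛ (q ⊛ s)
⊛-assoc p q s n = begin
    Σ≤ n (λ i → Σ≤ i (λ j → p j * q (i ∸ j)) * s (n ∸ i))
  ≡⟨ Σ≤-cong n (λ i _ → *-distribʳ-Σ≤ i (s (n ∸ i)) (λ j → p j * q (i ∸ j))) ⟩
    Σ≤ n (λ i → Σ≤ i (λ j → p j * q (i ∸ j) * s (n ∸ i)))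
  ≡⟨ Σ≤-triangle n (λ i j → p j * q (i ∸ j) * s (n ∸ i)) ⟩
    Σ≤ n (λ j → Σ≤ (n ∸ j) (λ l → p j * q ((j ℕ.+ l) ∸ j) * s (n ∸ (j ℕ.+ l))))
  ≡⟨ Σ≤-cong n (λ j _ → Σ≤-cong (n ∸ j) (λ l _ → reindex j l)) ⟩
    Σ≤ n (λ j → Σ≤ (n ∸ j) (λ l → p j * (q l * s ((n ∸ j) ∸ l))))
  ≡⟨ Σ≤-cong n (λ j _ → *-distribˡ-Σ≤ (n ∸ j) (p j) (λ l → q l * s ((n ∸ j) ∸ l))) ⟨
    Σ≤ n (λ j → p j * Σ≤ (n ∸ j) (λ l → q l * s ((n ∸ j) ∸ l)))
  ∎
  where
  open ≡-Reasoning
  reindex : ∀ j l → p j * q ((j ℕ.+ l) ∸ j) * s (n ∸ (j ℕ.+ l)) ≡ p j * (q l * s ((n ∸ j) ∸ l))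
  reindex j l rewrite ℕ.m+n∸m≡n j l | sym (ℕ.∸-+-assoc n j l) = ℤ.*-assoc (p j) (q l) (s ((n ∸ j) ∸ l))

⊛-identityˡ : ∀ p → one ⊛ p ≗ p
⊛-identityˡ p n = trans (Σ≤-single n 0 (λ i → one i * p (n ∸ i)) z≤n off-zero) (ℤ.*-identityˡ (p n))
  where
  off-zero : ∀ i → i ≤ n → ¬ i ≡ 0 → one i * p (n ∸ i) ≡ 0ℤ
  off-zero zero    _ i≢0 = ⊥-elim (i≢0 refl)
  off-zero (suc i) _ _   = ℤ.*-zeroˡ (p (n ∸ suc i))

⊛-identityʳ : ∀ p → p ⊛ one ≗ p
⊛-identityʳ p n = trans (⊛-comm p one n) (⊛-identityˡ p n)

X⊛-zero : ∀ s → (X ⊛ s) 0 ≡ 0ℤ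
X⊛-zero s = ℤ.*-zeroˡ (s 0)

X⊛-suc : ∀ s n → (X ⊛ s) (suc n) ≡ s n
X⊛-suc s n = trans (Σ≤-single (suc n) 1 (λ i → X i * s (suc n ∸ i)) (s≤s z≤n) off-one) (ℤ.*-identityˡ (s n))
  where
  off-one : ∀ i → i ≤ suc n → ¬ i ≡ 1 → X i * s (suc n ∸ i) ≡ 0ℤ
  off-one zero          _ _   = ℤ.*-zeroˡ (s (suc n))
  off-one (suc zero)    _ i≢1 = ⊥-elim (i≢1 refl)
  off-one (suc (suc i)) _ _   = ℤ.*-zeroˡ (s (n ∸ suc i))

⊛-X-shift : ∀ p q n → (p ⊛ (X ⊛ q)) (suc n) ≡ (p ⊛ q) n
⊛-X-shift p q n = begin
  (p ⊛ (X ⊛ q)) (suc n)  ≡⟨ ⊛-assoc p X q (suc n) ⟨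
  ((p ⊛ X) ⊛ q) (suc n)  ≡⟨ ⊛-congˡ q (⊛-comm p X) (suc n) ⟩
  ((X ⊛ p) ⊛ q) (suc n)  ≡⟨ ⊛-assoc X p q (suc n) ⟩
  (X ⊛ (p ⊛ q)) (suc n)  ≡⟨ X⊛-suc (p ⊛ q) n ⟩
  (p ⊛ q) n              ∎
  where open ≡-Reasoning

⊛-Σ≤ : ∀ e N (b : ℕ → ℤ) (P : ℕ → PS) n →
       (e ⊛ (λ m → Σ≤ N (λ j → b j * P j m))) n ≡ Σ≤ N (λ j → b j * (e ⊛ P j) n)
⊛-Σ≤ e N b P n = begin
    Σ≤ n (λ i → e i * Σ≤ N (λ j → b j * P j (n ∸ i)))
  ≡⟨ Σ≤-cong n (λ i _ → *-distribˡ-Σ≤ N (e i) (λ j → b j * P j (n ∸ i))) ⟩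
    Σ≤ n (λ i → Σ≤ N (λ j → e i * (b j * P j (n ∸ i))))
  ≡⟨ Σ≤-swap n N (λ i j → e i * (b j * P j (n ∸ i))) ⟩
    Σ≤ N (λ j → Σ≤ n (λ i → e i * (b j * P j (n ∸ i))))
  ≡⟨ Σ≤-cong N (λ j _ → Σ≤-cong n (λ i _ → left-commute (e i) (b j) (P j (n ∸ i)))) ⟩
    Σ≤ N (λ j → Σ≤ n (λ i → b j * (e i * P j (n ∸ i))))
  ≡⟨ Σ≤-cong N (λ j _ → *-distribˡ-Σ≤ n (b j) (λ i → e i * P j (n ∸ i))) ⟨
    Σ≤ N (λ j → b j * Σ≤ n (λ i → e i * P j (n ∸ i)))
  ∎
  where
  open ≡-Reasoning
  left-commute : ∀ a b c → a * (b * c) ≡ b * (a * c)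
  left-commute = solve-∀

^ˢ-congUpTo : ∀ n {p q} → AgreeUpTo n p q → ∀ j → AgreeUpTo n (p ^ˢ j) (q ^ˢ j)
^ˢ-congUpTo n p≈q zero    i _ = refl
^ˢ-congUpTo n p≈q (suc j)     = ⊛-congUpTo n p≈q (^ˢ-congUpTo n p≈q j)

^ˢ-+ : ∀ p k j → (p ^ˢ k) ⊛ (p ^ˢ j) ≗ p ^ˢ (k ℕ.+ j)
^ˢ-+ p zero    j n = ⊛-identityˡ (p ^ˢ j) n
^ˢ-+ p (suc k) j n = trans (⊛-assoc p (p ^ˢ k) (p ^ˢ j) n) (⊛-congʳ p (^ˢ-+ p k j) n)

module _ {p : PS} (p0≡0 : p 0 ≡ 0ℤ) where

  ^ˢ-below : ∀ j m → m < j → (p ^ˢ j) m ≡ 0ℤ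
  ^ˢ-below (suc j) m (s≤s m≤j) = Σ≤-zero m (λ i → p i * (p ^ˢ j) (m ∸ i)) term≡0
    where
    term≡0 : ∀ i → i ≤ m → p i * (p ^ˢ j) (m ∸ i) ≡ 0ℤ
    term≡0 zero    _ rewrite p0≡0 = ℤ.*-zeroˡ ((p ^ˢ j) m)
    term≡0 (suc i) i<m = trans (cong (p (suc i) *_) (^ˢ-below j (m ∸ suc i) m∸i<j)) (ℤ.*-zeroʳ (p (suc i)))
      where
      m∸i<j : m ∸ suc i < j
      m∸i<j = ℕ.<-≤-trans (ℕ.∸-monoʳ-< {o = 0} (s≤s z≤n) i<m) m≤j

  ^ˢ-diagonal : ∀ k → (p ^ˢ k) k ≡ p 1 ^ k
  ^ˢ-diagonal zero    = refl
  ^ˢ-diagonal (suc k) =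
    trans (Σ≤-single (suc k) 1 (λ i → p i * (p ^ˢ k) (suc k ∸ i)) (s≤s z≤n) off-one)
          (cong (p 1 *_) (^ˢ-diagonal k))
    where
    off-one : ∀ i → i ≤ suc k → ¬ i ≡ 1 → p i * (p ^ˢ k) (suc k ∸ i) ≡ 0ℤ
    off-one zero          _         _   rewrite p0≡0 = ℤ.*-zeroˡ ((p ^ˢ k) (suc k))
    off-one (suc zero)    _         i≢1 = ⊥-elim (i≢1 refl)
    off-one (suc (suc i)) (s≤s i<k) _   =
      trans (cong (p (suc (suc i)) *_) (^ˢ-below k (k ∸ suc i) (ℕ.∸-monoʳ-< {o = 0} (s≤s z≤n) i<k)))
            (ℤ.*-zeroʳ (p (suc (suc i))))

LowerTriangular : Matrix → Set
LowerTriangular M = ∀ n k → n < k → M n k ≡ 0ℤ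

module _ (d : PS) {h : PS} (h0≡0 : h 0 ≡ 0ℤ) where

  riordan-lowerTriangular : LowerTriangular (riordan d h)
  riordan-lowerTriangular n k n<k = Σ≤-zero n (λ i → d i * (h ^ˢ k) (n ∸ i)) term≡0
    where
    term≡0 : ∀ i → i ≤ n → d i * (h ^ˢ k) (n ∸ i) ≡ 0ℤ
    term≡0 i _ = trans (cong (d i *_) (^ˢ-below h0≡0 k (n ∸ i) (ℕ.≤-<-trans (ℕ.m∸n≤m n i) n<k)))
                       (ℤ.*-zeroʳ (d i))

  riordan-diagonal : ∀ n → riordan d h n n ≡ d 0 * h 1 ^ n
  riordan-diagonal n =
    trans (Σ≤-single n 0 (λ i → d i * (h ^ˢ n) (n ∸ i)) z≤n off-zero)
          (cong (d 0 *_) (^ˢ-diagonal h0≡0 n))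
    where
    off-zero : ∀ i → i ≤ n → ¬ i ≡ 0 → d i * (h ^ˢ n) (n ∸ i) ≡ 0ℤ
    off-zero zero    _   i≢0 = ⊥-elim (i≢0 refl)
    off-zero (suc i) i<n _   =
      trans (cong (d (suc i) *_) (^ˢ-below h0≡0 n (n ∸ suc i) (ℕ.∸-monoʳ-< {o = 0} (s≤s z≤n) i<n)))
            (ℤ.*-zeroʳ (d (suc i)))

-- [x^m] β(p), truncated at j = m; the truncation is exact when p 0 ≡ 0.
compose : PS → PS → PS
compose β p m = Σ≤ m (λ j → β j * (p ^ˢ j) m)

compose-congUpTo : ∀ β n {p q} → AgreeUpTo n p q → AgreeUpTo n (compose β p) (compose β q)
compose-congUpTo β n p≈q i i≤n = Σ≤-cong i (λ j _ → cong (β j *_) (^ˢ-congUpTo n p≈q j i i≤n))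

⊛-compose : ∀ β {h} → h 0 ≡ 0ℤ → ∀ e n → (e ⊛ compose β h) n ≡ Σ≤ n (λ j → β j * (e ⊛ (h ^ˢ j)) n)
⊛-compose β {h} h0≡0 e n =
  trans (⊛-cong-at n {p = e} (λ _ _ → refl) untruncate) (⊛-Σ≤ e n β (h ^ˢ_) n)
  where
  untruncate : AgreeUpTo n (compose β h) (λ m → Σ≤ n (λ j → β j * (h ^ˢ j) m))
  untruncate m m≤n = sym (Σ≤-vanishing-tail m n (λ j → β j * (h ^ˢ j) m) m≤n
    (λ j m<j _ → trans (cong (β j *_) (^ˢ-below h0≡0 j m m<j)) (ℤ.*-zeroʳ (β j))))

-- Iterating h ↦ x β(h) from 0 fixes one more coefficient at each step.
approx : PS → ℕ → PS
approx β zero    = λ _ → 0ℤ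
approx β (suc m) = X ⊛ compose β (approx β m)

fixedPoint : PS → PS
fixedPoint β n = approx β n n

approx-step : ∀ β m → AgreeUpTo m (approx β m) (approx β (suc m))
approx-step β zero    zero    _ = sym (X⊛-zero (compose β (approx β 0)))
approx-step β (suc m) zero    _ =
  trans (X⊛-zero (compose β (approx β m))) (sym (X⊛-zero (compose β (approx β (suc m)))))
approx-step β (suc m) (suc i) (s≤s i≤m) = begin
  (X ⊛ compose β (approx β m)) (suc i)        ≡⟨ X⊛-suc (compose β (approx β m)) i ⟩
  compose β (approx β m) i                    ≡⟨ compose-congUpTo β m (approx-step β m) i i≤m ⟩
  compose β (approx β (suc m)) i              ≡⟨ X⊛-suc (compose β (approx β (suc m))) i ⟨
  (X ⊛ compose β (approx β (suc m))) (suc i)  ∎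
  where open ≡-Reasoning

fixedPoint-approx : ∀ β m → AgreeUpTo m (fixedPoint β) (approx β m)
fixedPoint-approx β zero    zero z≤n = refl
fixedPoint-approx β (suc m) i i≤1+m with ℕ.m≤n⇒m<n∨m≡n i≤1+m
... | inj₂ refl        = refl
... | inj₁ (s≤s i≤m) = trans (fixedPoint-approx β m i i≤m) (approx-step β m i i≤m)

fixedPoint-one : ∀ β → fixedPoint β 1 ≡ β 0 * 1ℤ
fixedPoint-one β = X⊛-suc (compose β (approx β 0)) 0

fixedPoint-equation : ∀ β → fixedPoint β ≗ X ⊛ compose β (fixedPoint β)
fixedPoint-equation β zero    = sym (X⊛-zero (compose β (fixedPoint β)))
fixedPoint-equation β (suc n) = begin
  (X ⊛ compose β (approx β n)) (suc n)     ≡⟨ X⊛-suc (compose β (approx β n)) n ⟩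
  compose β (approx β n) n                 ≡⟨ compose-congUpTo β n (fixedPoint-approx β n) n ℕ.≤-refl ⟨
  compose β (fixedPoint β) n               ≡⟨ X⊛-suc (compose β (fixedPoint β)) n ⟨
  (X ⊛ compose β (fixedPoint β)) (suc n)   ∎
  where open ≡-Reasoning

riordan-ASequence : ∀ d β {h} → h 0 ≡ 0ℤ → h ≗ X ⊛ compose β h → IsASequence (riordan d h) β
riordan-ASequence d β {h} h0≡0 h≗xβ[h] n k = begin
    (d ⊛ (h ⊛ hᵏ)) (suc n)
  ≡⟨ ⊛-congʳ d (λ m → trans (⊛-congˡ hᵏ h≗xβ[h] m) (⊛-assoc X β[h] hᵏ m)) (suc n) ⟩
    (d ⊛ (X ⊛ (β[h] ⊛ hᵏ))) (suc n)
  ≡⟨ ⊛-X-shift d (β[h] ⊛ hᵏ) n ⟩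
    (d ⊛ (β[h] ⊛ hᵏ)) n
  ≡⟨ ⊛-congʳ d (⊛-comm β[h] hᵏ) n ⟩
    (d ⊛ (hᵏ ⊛ β[h])) n
  ≡⟨ ⊛-assoc d hᵏ β[h] n ⟨
    ((d ⊛ hᵏ) ⊛ β[h]) n
  ≡⟨ ⊛-compose β h0≡0 (d ⊛ hᵏ) n ⟩
    Σ≤ n (λ j → β j * ((d ⊛ hᵏ) ⊛ (h ^ˢ j)) n)
  ≡⟨ Σ≤-cong n (λ j _ → cong (β j *_) (merge j)) ⟩
    Σ≤ n (λ j → β j * (d ⊛ (h ^ˢ (k ℕ.+ j))) n)
  ∎
  where
  open ≡-Reasoning
  hᵏ = h ^ˢ k
  β[h] = compose β h
  merge : ∀ j → ((d ⊛ hᵏ) ⊛ (h ^ˢ j)) n ≡ (d ⊛ (h ^ˢ (k ℕ.+ j))) n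
  merge j = trans (⊛-assoc d hᵏ (h ^ˢ j) n) (⊛-congʳ d (^ˢ-+ h k j) n)

ASequence⇒Riordan : ∀ M β → ¬ β 0 ≡ 0ℤ → ¬ M 0 0 ≡ 0ℤ → (∀ k → M 0 (suc k) ≡ 0ℤ) →
                    IsASequence M β → IsRiordan M
ASequence⇒Riordan M β β0≢0 M00≢0 row0≡0 M-A = d , h , M00≢0 , h0≡0 , h1≢0 , M≡riordan
  where
  d : PS
  d n = M n 0
  h = fixedPoint β
  h0≡0 : h 0 ≡ 0ℤ
  h0≡0 = refl
  h1≢0 : ¬ h 1 ≡ 0ℤ
  h1≢0 h1≡0 = β0≢0 (trans (sym (ℤ.*-identityʳ (β 0))) (trans (sym (fixedPoint-one β)) h1≡0))
  M≡riordan : ∀ n k → M n k ≡ riordan d h n k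
  M≡riordan zero    zero    = sym (⊛-identityʳ d 0)
  M≡riordan zero    (suc k) = trans (row0≡0 k) (sym (riordan-lowerTriangular d {h} h0≡0 0 (suc k) (s≤s z≤n)))
  M≡riordan (suc n) zero    = sym (⊛-identityʳ d (suc n))
  M≡riordan (suc n) (suc k) = begin
    M (suc n) (suc k)                           ≡⟨ M-A n k ⟩
    Σ≤ n (λ j → β j * M n (k ℕ.+ j))            ≡⟨ Σ≤-cong n (λ j _ → cong (β j *_) (M≡riordan n (k ℕ.+ j))) ⟩
    Σ≤ n (λ j → β j * riordan d h n (k ℕ.+ j))  ≡⟨ riordan-ASequence d β {h} h0≡0 (fixedPoint-equation β) n k ⟨
    riordan d h (suc n) (suc k)                 ∎
    where open ≡-Reasoning

module _ {M : Matrix} (lower : LowerTriangular M) where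

  Σ≤-row-truncate : ∀ (t : ℕ → ℤ) N K {m m'} → N ≤ K ℕ.+ m → m ≤ m' →
                    Σ≤ m' (λ i → t i * M N (K ℕ.+ i)) ≡ Σ≤ m (λ i → t i * M N (K ℕ.+ i))
  Σ≤-row-truncate t N K N≤K+m m≤m' = Σ≤-vanishing-tail _ _ _ m≤m' beyond-diagonal
    where
    beyond-diagonal : ∀ i → _ < i → i ≤ _ → t i * M N (K ℕ.+ i) ≡ 0ℤ
    beyond-diagonal i m<i _ =
      trans (cong (t i *_) (lower N (K ℕ.+ i) (ℕ.≤-<-trans N≤K+m (ℕ.+-monoʳ-< K m<i)))) (ℤ.*-zeroʳ (t i))

  ASequence-twice : ∀ {α} → IsASequence M α →
                    ∀ N K → M (2 ℕ.+ N) (2 ℕ.+ K) ≡ Σ≤ N (λ s → (α ⊛ α) s * M N (K ℕ.+ s))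
  ASequence-twice {α} M-A N K = begin
      M (suc (suc N)) (suc (suc K))
    ≡⟨ M-A (suc N) (suc K) ⟩
      Σ≤ (suc N) (λ j → α j * M (suc N) (suc K ℕ.+ j))
    ≡⟨ Σ≤-row-truncate α (suc N) (suc K) (s≤s (ℕ.m≤n+m N K)) (ℕ.n≤1+n N) ⟩
      Σ≤ N (λ j → α j * M (suc N) (suc (K ℕ.+ j)))
    ≡⟨ Σ≤-cong N (λ j _ → cong (α j *_) (M-A N (K ℕ.+ j))) ⟩
      Σ≤ N (λ j → α j * Σ≤ N (λ i → α i * M N (K ℕ.+ j ℕ.+ i)))
    ≡⟨ Σ≤-cong N (λ j j≤N → cong (α j *_) (Σ≤-row-truncate α N (K ℕ.+ j) (N≤K+j+[N∸j] j j≤N) (ℕ.m∸n≤m N j))) ⟩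
      Σ≤ N (λ j → α j * Σ≤ (N ∸ j) (λ i → α i * M N (K ℕ.+ j ℕ.+ i)))
    ≡⟨ Σ≤-cong N (λ j _ → trans (*-distribˡ-Σ≤ (N ∸ j) (α j) (λ i → α i * M N (K ℕ.+ j ℕ.+ i)))
                                 (Σ≤-cong (N ∸ j) (λ i _ → regroup j i))) ⟩
      Σ≤ N (λ j → Σ≤ (N ∸ j) (λ l → α j * α ((j ℕ.+ l) ∸ j) * M N (K ℕ.+ (j ℕ.+ l))))
    ≡⟨ Σ≤-triangle N (λ s j → α j * α (s ∸ j) * M N (K ℕ.+ s)) ⟨
      Σ≤ N (λ s → Σ≤ s (λ j → α j * α (s ∸ j) * M N (K ℕ.+ s)))
    ≡⟨ Σ≤-cong N (λ s _ → *-distribʳ-Σ≤ s (M N (K ℕ.+ s)) (λ j → α j * α (s ∸ j))) ⟨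
      Σ≤ N (λ s → (α ⊛ α) s * M N (K ℕ.+ s))
    ∎
    where
    open ≡-Reasoning
    N≤K+j+[N∸j] : ∀ j → j ≤ N → N ≤ K ℕ.+ j ℕ.+ (N ∸ j)
    N≤K+j+[N∸j] j j≤N = subst (_≤ K ℕ.+ j ℕ.+ (N ∸ j)) (ℕ.m+[n∸m]≡n j≤N)
                               (ℕ.+-monoˡ-≤ (N ∸ j) (ℕ.m≤n+m j K))
    regroup : ∀ j i → α j * (α i * M N (K ℕ.+ j ℕ.+ i)) ≡ α j * α ((j ℕ.+ i) ∸ j) * M N (K ℕ.+ (j ℕ.+ i))
    regroup j i rewrite ℕ.m+n∸m≡n j i | ℕ.+-assoc K j i = sym (ℤ.*-assoc (α j) (α i) (M N (K ℕ.+ (j ℕ.+ i))))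

cMat-ASequence : ∀ {M α} → LowerTriangular M → IsASequence M α → ∀ r → IsASequence (cMat M r) (α ⊛ α)
cMat-ASequence {M} {α} lower M-A r n k = begin
    cMat M r (suc n) (suc k)
  ≡⟨ cong₂ M (cong (λ z → suc (z ℕ.+ r)) (ℕ.+-suc n n)) (cong (λ z → suc (z ℕ.+ r)) (ℕ.+-suc n k)) ⟩
    M (2 ℕ.+ N) (2 ℕ.+ K)
  ≡⟨ ASequence-twice lower {α} M-A N K ⟩
    Σ≤ N (λ s → (α ⊛ α) s * M N (K ℕ.+ s))
  ≡⟨ Σ≤-row-truncate lower (α ⊛ α) N K N≤K+n (ℕ.≤-trans (ℕ.m≤m+n n n) (ℕ.m≤m+n (n ℕ.+ n) r)) ⟩
    Σ≤ n (λ s → (α ⊛ α) s * M N (K ℕ.+ s))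
  ≡⟨ Σ≤-cong n (λ s _ → cong (λ z → (α ⊛ α) s * M N z) (column-index s)) ⟨
    Σ≤ n (λ s → (α ⊛ α) s * cMat M r n (k ℕ.+ s))
  ∎
  where
  open ≡-Reasoning
  N = n ℕ.+ n ℕ.+ r
  K = n ℕ.+ k ℕ.+ r
  N≤K+n : N ≤ K ℕ.+ n
  N≤K+n = subst (N ≤_) (rearrange n k r) (ℕ.m≤m+n N k)
    where
    rearrange : ∀ n k r → n ℕ.+ n ℕ.+ r ℕ.+ k ≡ n ℕ.+ k ℕ.+ r ℕ.+ n
    rearrange = ℕ-Solver.solve-∀
  column-index : ∀ s → n ℕ.+ (k ℕ.+ s) ℕ.+ r ≡ K ℕ.+ s
  column-index s = rearrange n k s r
    where
    rearrange : ∀ n k s r → n ℕ.+ (k ℕ.+ s) ℕ.+ r ≡ n ℕ.+ k ℕ.+ r ℕ.+ s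
    rearrange = ℕ-Solver.solve-∀

riordan-unitDiagonal : ∀ g f → g 0 ≡ 1ℤ → f 0 ≡ 1ℤ → ∀ n → riordan g (X ⊛ f) n n ≡ 1ℤ
riordan-unitDiagonal g f g0≡1 f0≡1 n = begin
  riordan g (X ⊛ f) n n        ≡⟨ riordan-diagonal g {X ⊛ f} (X⊛-zero f) n ⟩
  g 0 * (X ⊛ f) 1 ^ n          ≡⟨ cong₂ (λ a b → a * b ^ n) g0≡1 (trans (X⊛-suc f 0) f0≡1) ⟩
  1ℤ * 1ℤ ^ n                  ≡⟨ trans (ℤ.*-identityˡ (1ℤ ^ n)) (ℤ.^-zeroˡ n) ⟩
  1ℤ                           ∎
  where open ≡-Reasoning

mainTheorem13 : (g f : PS) → g 0 ≡ 1ℤ → f 0 ≡ 1ℤ → (r : ℕ) → (α : PS) →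
    IsASequence (riordan g (X ⊛ f)) α →
    IsRiordan (cMat (riordan g (X ⊛ f)) r) × IsASequence (cMat (riordan g (X ⊛ f)) r) (α ⊛ α)
mainTheorem13 g f g0≡1 f0≡1 r α A-α =
  ASequence⇒Riordan c (α ⊛ α) [α⊛α]0≢0 c00≢0 c0k≡0 c-A , c-A
  where
  A = riordan g (X ⊛ f)
  lower : LowerTriangular A
  lower = riordan-lowerTriangular g {X ⊛ f} (X⊛-zero f)
  diagonal : ∀ n → A n n ≡ 1ℤ
  diagonal = riordan-unitDiagonal g f g0≡1 f0≡1
  α0≡1 : α 0 ≡ 1ℤ
  α0≡1 = trans (sym (ℤ.*-identityʳ (α 0)))
               (trans (cong (α 0 *_) (sym (diagonal 0))) (trans (sym (A-α 0 0)) (diagonal 1)))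
  1≢0 : ¬ 1ℤ ≡ 0ℤ
  1≢0 ()
  c = cMat A r
  c-A = cMat-ASequence {α = α} lower A-α r
  [α⊛α]0≢0 : ¬ (α ⊛ α) 0 ≡ 0ℤ
  [α⊛α]0≢0 e = 1≢0 (trans (sym (cong₂ _*_ α0≡1 α0≡1)) e)
  c00≢0 : ¬ c 0 0 ≡ 0ℤ
  c00≢0 e = 1≢0 (trans (sym (diagonal r)) e)
  c0k≡0 : ∀ k → c 0 (suc k) ≡ 0ℤ
  c0k≡0 k = lower r (suc (k ℕ.+ r)) (s≤s (ℕ.m≤n+m r k))
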